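{- Let $n\ge 2$, $k\in\{0,\ldots,n-2\}$ and $p_\alpha\in\mathcal{S}_n$ with $\varpi$-system digits $\alpha_0,\ldots,\alpha_{n-2}$. Let $\mathcal{O}_{n,k+1}(q_\delta)$ be the $(k+1)$-orbit containing $p_\alpha$. This $(k+1)$-orbit is the union of the $n-k$ $k$-orbits $\mathcal{O}_{n,k}(q_{(n-k)\delta+j})$, $j=0,\ldots,n-k-1$ (listed in order), and the digit $\alpha_k$ equals the index $j$ of the $k$-orbit among them that contains $p_\alpha$; i.e. $\alpha_k$ is the rank of the $k$-orbit containing $p_\alpha$ within the $(k+1)$-orbit containing $p_\alpha$.
   Context: For $m\ge1$, $\mathcal{S}_m$ is the set of permutations of distinct symbols $x_1,\ldots,x_m$, ordered by generation by cyclic shift: $\mathcal{S}_1=((x_1))$, and if $\mathcal{S}_{m-1}=(q_0,\ldots,q_{(m-1)!-1})$ then $\mathcal{S}_m=(p_0,\ldots,p_{m!-1})$ with $p_{m\beta+j}=C^j(q_\beta x_m)$, $0\le j\le m-1$, where $q_\beta x_m$ appends $x_m$ on the right and $C(c_1c_2\cdots c_m)=(c_2\cdots c_mc_1)$; indices are ranks. $\varpi_{n,0}=1$, $\varpi_{n,i}=n(n-1)\cdots(n-i+1)$; every rank $\alpha\in\{0,\ldots,n!-1\}$ is uniquely $\sum_{i=0}^{n-2}\alpha_i\varpi_{n,i}$ with $\alpha_i\in\{0,\ldots,n-i-1\}$. For $0\le k\le n-2$ and $q_\beta\in\mathcal{S}_{n-k}$, the $k$-orbit is $\mathcal{O}_{n,k}(q_\beta)=\{p_\alpha:\alpha=\beta\varpi_{n,k}+\gamma,\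 0\le\gamma\le\varpi_{n,k}-1\}$; the $(n-1)$-orbit is by convention $\mathcal{O}_{n,n-1}((x_1))=\mathcal{S}_n$ (with $\delta=0$). -}

module Defs where

open import Data.Nat using (ℕ; zero; suc; _+_; _*_; _∸_; _<_)
open import Data.List using (List; []; _∷_; _++_; [_]; map; concatMap; upTo)
open import Data.Maybe using (Maybe; just; nothing)
open import Data.Product using (Σ; _×_; ∃-syntax)
open import Relation.Binary.PropositionalEquality using (_≡_)

-- Symbols x_1, …, x_m are represented by the natural numbers 1, …, m;
-- a permutation is the list c_1 c_2 … c_m of its symbols.
Perm : Set
Perm = List ℕ

C : Perm → Perm
C []       = []
C (c ∷ cs) = cs ++ [ c ]

C^ : ℕ → Perm → Perm
C^ zero    p = p
C^ (suc j) p = C^ j (C p)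

-- 𝒮_m as the ordered list (p_0, …, p_{m!-1}); only meaningful for m ≥ 1.
-- 𝒮_1 = ((x_1)); p_{mβ+j} = C^j(q_β x_m), 0 ≤ j ≤ m-1.
𝒮 : ℕ → List Perm
𝒮 zero          = []
𝒮 (suc zero)    = [ 1 ∷ [] ] 
𝒮 (suc (suc m)) =
  concatMap (λ q → map (λ j → C^ j (q ++ [ suc (suc m) ])) (upTo (suc (suc m))))
            (𝒮 (suc m))

at : {A : Set} → List A → ℕ → Maybe A
at []       _       = nothing
at (x ∷ xs) zero    = just x
at (x ∷ xs) (suc i) = at xs i

ϖ : ℕ → ℕ → ℕ
ϖ n zero    = 1
ϖ n (suc i) = ϖ n i * (n ∸ i)

Σ< : ℕ → (ℕ → ℕ) → ℕ
Σ< zero    f = 0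
Σ< (suc m) f = Σ< m f + f m

InOrbit : (n k β : ℕ) → Perm → Set
InOrbit n k β p = ∃[ γ ] (γ < ϖ n k × at (𝒮 n) (β * ϖ n k + γ) ≡ just p)

-- Ranking in 𝒮ₙ is invertible: p_α = Cʲ(q_β xₙ) with α = nβ + j, and j is read off from the
-- position of the largest symbol xₙ in p_α, after which q_β is recovered by undoing the rotation and
-- deleting xₙ, so β is found recursively. Hence α ↦ p_α is injective and every permutation lies in
-- exactly one k-orbit. The ranks of a (k+1)-orbit form an interval of length
-- ϖ_{n,k+1} = ϖ_{n,k}(n−k), which cuts into n−k consecutive intervals of length ϖ_{n,k}: these
-- are its k-orbits. Finally, the digit expansion gives α = ((n−k)A + α_k)ϖ_{n,k} + r with
-- r < ϖ_{n,k}, so p_α lies in the k-orbit numbered (n−k)A + α_k, which forces A = δ.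
module Submission where

open import Defs
open import Data.Nat using (ℕ; zero; suc; _+_; _*_; _∸_; _≤_; _<_; _!; z≤n; s≤s; z<s; s<s; _≟_; s≤s⁻¹)
open import Data.Nat.Properties
open import Data.Nat.DivMod using (_/_; _%_; m≡m%n+[m/n]*n; m%n<n; m<n*o⇒m/o<n; m<n⇒m%n≡m; [m+kn]%n≡m%n)
open import Data.Nat.Divisibility using (_∣_; divides; ∣-refl; ∣-trans; m∣m*n)
open import Data.Nat.Solver using (module +-*-Solver)
open import Data.Product as Product using (_×_; ∃-syntax; _,_)
open import Data.Sum using (_⊎_; inj₁; inj₂)
open import Data.Maybe using (just)
open import Data.List using (List; []; _∷_; _++_; [_]; map; concatMap; upTo; applyUpTo; length; drop; take; break)
open import Data.List.Properties using (++-assoc; ++-identityʳ; length-++; length-take; take++drop≡id; map-upTo; length-applyUpTo)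
open import Data.List.Relation.Unary.All as All using (All; []; _∷_)
open import Data.List.Relation.Unary.All.Properties as All using (drop⁺; ++⁺)
open import Function using (_∘_)
open import Function.Bundles using (_⇔_; mk⇔; Equivalence)
open import Relation.Binary.PropositionalEquality hiding ([_])
open import Relation.Nullary using (yes; no; ¬_; contradiction)
open import Relation.Unary using (Decidable)
open +-*-Solver using (solve; _:+_; _:*_; _:=_)

at-++⁻ : ∀ {A : Set} (xs ys : List A) {i x} → at (xs ++ ys) i ≡ just x →
  (i < length xs × at xs i ≡ just x) ⊎ (∃[ i′ ] (i ≡ length xs + i′ × at ys i′ ≡ just x))
at-++⁻ []       ys {i}     eq = inj₂ (i , refl , eq)
at-++⁻ (x ∷ xs) ys {zero}  eq = inj₁ (z<s , eq)
at-++⁻ (x ∷ xs) ys {suc i} eq with at-++⁻ xs ys eq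
... | inj₁ (i< , eq′)      = inj₁ (s<s i< , eq′)
... | inj₂ (i′ , i≡ , eq′) = inj₂ (i′ , cong suc i≡ , eq′)

at-concatMap⁻ : ∀ {A B : Set} (f : A → List B) {L} → (∀ x → length (f x) ≡ L) →
  ∀ xs {i y} → at (concatMap f xs) i ≡ just y →
  ∃[ β ] ∃[ j ] ∃[ x ] (i ≡ β * L + j × j < L × at xs β ≡ just x × at (f x) j ≡ just y)
at-concatMap⁻ f len (x ∷ xs) {i} eq with at-++⁻ (f x) (concatMap f xs) eq
... | inj₁ (i< , eq′) = 0 , i , x , refl , subst (i <_) (len x) i< , refl , eq′
... | inj₂ (i′ , refl , eq′) with at-concatMap⁻ f len xs eq′
...   | β , j , x′ , refl , j< , eq₁ , eq₂ =
  suc β , j , x′ , trans (cong (_+ _) (len x)) (sym (+-assoc _ (β * _) j)) , j< , eq₁ , eq₂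

at-applyUpTo⁻ : ∀ {A : Set} (f : ℕ → A) L {j x} → at (applyUpTo f L) j ≡ just x → j < L × f j ≡ x
at-applyUpTo⁻ f (suc L) {zero}  refl = z<s , refl
at-applyUpTo⁻ f (suc L) {suc j} eq   = Product.map₁ s<s (at-applyUpTo⁻ (f ∘ suc) L eq)

C^-++ : ∀ j (xs ys : Perm) → j ≤ length xs → C^ j (xs ++ ys) ≡ drop j xs ++ ys ++ take j xs
C^-++ zero    xs       ys _         = cong (xs ++_) (sym (++-identityʳ ys))
C^-++ (suc j) (x ∷ xs) ys (s≤s j≤) = begin
  C^ j ((xs ++ ys) ++ [ x ])          ≡⟨ cong (C^ j) (++-assoc xs ys [ x ]) ⟩
  C^ j (xs ++ ys ++ [ x ])            ≡⟨ C^-++ j xs (ys ++ [ x ]) j≤ ⟩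
  drop j xs ++ (ys ++ [ x ]) ++ take j xs ≡⟨ cong (drop j xs ++_) (++-assoc ys [ x ] (take j xs)) ⟩
  drop j xs ++ ys ++ x ∷ take j xs    ∎
  where open ≡-Reasoning

length-C^ : ∀ j (xs : Perm) → length (C^ j xs) ≡ length xs
length-C^ zero    xs       = refl
length-C^ (suc j) []       = length-C^ j []
length-C^ (suc j) (x ∷ xs) = trans (length-C^ j (xs ++ [ x ])) (trans (length-++ xs) (+-comm (length xs) 1))

All-C^ : ∀ {P : ℕ → Set} j {xs : Perm} → All P xs → All P (C^ j xs)
All-C^ zero    pxs        = pxs
All-C^ (suc j) []         = All-C^ j []
All-C^ (suc j) (px ∷ pxs) = All-C^ j (++⁺ pxs (px ∷ []))

break-++ : ∀ {P : ℕ → Set} (P? : Decidable P) {a y} b → All (¬_ ∘ P) a → P y →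
  break P? (a ++ y ∷ b) ≡ (a , y ∷ b)
break-++ P? {[]} {y} b [] py with P? y
... | yes _   = refl
... | no ¬py = contradiction py ¬py
break-++ P? {x ∷ a} b (¬px ∷ ¬pa) py with P? x
... | yes px = contradiction px ¬px
... | no _   rewrite break-++ P? b ¬pa py = refl

unrotate : ℕ → Perm → Perm × ℕ
unrotate M p = let (pre , post) = break (_≟ M) p in drop 1 post ++ pre , length post ∸ 1

unrotate-C^ : ∀ M j {q} → All (_≢ M) q → j ≤ length q → unrotate M (C^ j (q ++ [ M ])) ≡ (q , j)
unrotate-C^ M j {q} q≢M j≤ rewrite C^-++ j q [ M ] j≤ | break-++ (_≟ M) (take j q) (drop⁺ j q≢M) refl
  | take++drop≡id j q | length-take j q | m≤n⇒m⊓n≡m j≤ = refl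

insertions : ℕ → Perm → List Perm
insertions M q = map (λ j → C^ j (q ++ [ M ])) (upTo M)

length-insertions : ∀ M q → length (insertions M q) ≡ M
length-insertions M q = trans (cong length (map-upTo _ M)) (length-applyUpTo _ M)

at-insertions⁻ : ∀ M q {j p} → at (insertions M q) j ≡ just p → j < M × C^ j (q ++ [ M ]) ≡ p
at-insertions⁻ M q eq = at-applyUpTo⁻ _ M (subst (λ ps → at ps _ ≡ just _) (map-upTo _ M) eq)

at-𝒮⁻ : ∀ m {i p} → at (𝒮 (suc (suc m))) i ≡ just p →
  ∃[ β ] ∃[ j ] ∃[ q ] (i ≡ β * suc (suc m) + j × j < suc (suc m) × at (𝒮 (suc m)) β ≡ just q
                         × C^ j (q ++ [ suc (suc m) ]) ≡ p)
at-𝒮⁻ m eq with at-concatMap⁻ (insertions (suc (suc m))) (length-insertions _) (𝒮 (suc m)) eq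
... | β , j , q , i≡ , _ , eq₁ , eq₂ with at-insertions⁻ (suc (suc m)) q {j} eq₂
...   | j< , p≡ = β , j , q , i≡ , j< , eq₁ , p≡

length-C^-∷ʳ : ∀ j (q : Perm) M → length (C^ j (q ++ [ M ])) ≡ suc (length q)
length-C^-∷ʳ j q M = begin
  length (C^ j (q ++ [ M ])) ≡⟨ length-C^ j (q ++ [ M ]) ⟩
  length (q ++ [ M ])        ≡⟨ length-++ q ⟩
  length q + 1               ≡⟨ +-comm (length q) 1 ⟩
  suc (length q)             ∎
  where open ≡-Reasoning

at-𝒮-shape : ∀ n {i p} → at (𝒮 n) i ≡ just p → length p ≡ n × All (_≤ n) p
at-𝒮-shape zero          {_}     ()
at-𝒮-shape (suc zero)    {zero}  refl = refl , s≤s z≤n ∷ []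
at-𝒮-shape (suc zero)    {suc _} ()
at-𝒮-shape (suc (suc m)) eq =
  let (_ , j , q , _ , _ , eq₁ , p≡) = at-𝒮⁻ m eq
      (length-q , q≤) = at-𝒮-shape (suc m) eq₁
  in subst (λ p → length p ≡ suc (suc m) × All (_≤ suc (suc m)) p) p≡
       (trans (length-C^-∷ʳ j q _) (cong suc length-q) , All-C^ j (++⁺ (All.map m≤n⇒m≤1+n q≤) (≤-refl ∷ [])))

rank : ℕ → Perm → ℕ
rank (suc (suc m)) p = let (q , j) = unrotate (suc (suc m)) p in rank (suc m) q * suc (suc m) + j
rank _             _ = 0

rank-at : ∀ n {i p} → at (𝒮 n) i ≡ just p → rank n p ≡ i
rank-at zero          {_}     ()
rank-at (suc zero)    {zero}  refl = refl
rank-at (suc zero)    {suc _} ()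
rank-at (suc (suc m)) {i} {p} eq =
  let M = suc (suc m)
      (β , j , q , i≡ , j< , eq₁ , p≡) = at-𝒮⁻ m eq
      (length-q , q≤) = at-𝒮-shape (suc m) eq₁
      q≢M = All.map (<⇒≢ ∘ s≤s) q≤
      j≤ = subst (j ≤_) (sym length-q) (s≤s⁻¹ j<)
  in begin
    rank M p                        ≡⟨ cong (rank M) (sym p≡) ⟩
    rank M (C^ j (q ++ [ M ]))      ≡⟨ cong (λ (q′ , j′) → rank (suc m) q′ * M + j′) (unrotate-C^ M j q≢M j≤) ⟩
    rank (suc m) q * M + j          ≡⟨ cong (λ b → b * M + j) (rank-at (suc m) eq₁) ⟩
    β * M + j                       ≡⟨ sym i≡ ⟩
    i                               ∎
  where open ≡-Reasoning

at-𝒮-injective : ∀ n {a b p} → at (𝒮 n) a ≡ just p → at (𝒮 n) b ≡ just p → a ≡ b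
at-𝒮-injective n eqa eqb = trans (sym (rank-at n eqa)) (rank-at n eqb)

quotRem-injective : ∀ {m a b r s} → r < m → s < m → a * m + r ≡ b * m + s → a ≡ b × r ≡ s
quotRem-injective {m@(suc _)} {a} {b} {r} {s} r<m s<m eq = a≡b , r≡s
  where
  open ≡-Reasoning
  remainder : ∀ q t → t < m → (q * m + t) % m ≡ t
  remainder q t t<m = begin
    (q * m + t) % m ≡⟨ cong (_% m) (+-comm (q * m) t) ⟩
    (t + q * m) % m ≡⟨ [m+kn]%n≡m%n t q m ⟩
    t % m           ≡⟨ m<n⇒m%n≡m t<m ⟩
    t               ∎
  r≡s : r ≡ s
  r≡s = trans (sym (remainder a r r<m)) (trans (cong (_% m) eq) (remainder b s s<m))
  a≡b : a ≡ b
  a≡b = *-cancelʳ-≡ a b m (+-cancelʳ-≡ s (a * m) (b * m) (subst (λ t → a * m + t ≡ b * m + s) r≡s eq))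

quotRem-exists : ∀ {m n t} → t < m * n → ∃[ q ] ∃[ r ] (q < n × r < m × t ≡ q * m + r)
quotRem-exists {m@(suc _)} {n} {t} t< =
  t / m , t % m , m<n*o⇒m/o<n (subst (t <_) (*-comm m n) t<) , m%n<n t m ,
  trans (m≡m%n+[m/n]*n t m) (+-comm (t % m) (t / m * m))

quotRem-< : ∀ {m n q r} → q < n → r < m → q * m + r < m * n
quotRem-< {m} {n} {q} {r} q<n r<m = begin-strict
  q * m + r <⟨ +-monoʳ-< (q * m) r<m ⟩
  q * m + m ≡⟨ +-comm (q * m) m ⟩
  suc q * m ≤⟨ *-monoˡ-≤ m q<n ⟩
  n * m     ≡⟨ *-comm n m ⟩
  m * n     ∎
  where open ≤-Reasoning

InOrbit-suc⇔ : ∀ n k β r →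
  InOrbit n (suc k) β r ⇔ (∃[ j ] (j < n ∸ k × InOrbit n k ((n ∸ k) * β + j) r))
InOrbit-suc⇔ n k β r = mk⇔ to from
  where
  W N : ℕ
  W = ϖ n k
  N = n ∸ k
  at-index : ∀ j g → at (𝒮 n) (β * (W * N) + (j * W + g)) ≡ at (𝒮 n) ((N * β + j) * W + g)
  at-index j g = cong (at (𝒮 n))
    (solve 5 (λ β W N j g → β :* (W :* N) :+ (j :* W :+ g) := (N :* β :+ j) :* W :+ g) refl β W N j g)
  to : InOrbit n (suc k) β r → ∃[ j ] (j < N × InOrbit n k (N * β + j) r)
  to (γ , γ< , eq) with quotRem-exists {W} {N} γ<
  ... | j , g , j< , g< , refl = j , j< , g , g< , trans (sym (at-index j g)) eq
  from : ∃[ j ] (j < N × InOrbit n k (N * β + j) r) → InOrbit n (suc k) β r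
  from (j , j< , g , g< , eq) = j * W + g , quotRem-< j< g< , trans (at-index j g) eq

InOrbit-unique : ∀ n k {β β′ p} → InOrbit n k β p → InOrbit n k β′ p → β ≡ β′
InOrbit-unique n k (_ , γ< , eq) (_ , γ′< , eq′) =
  Product.proj₁ (quotRem-injective γ< γ′< (at-𝒮-injective n eq eq′))

ϖ-∣ : ∀ n i t → ϖ n t ∣ ϖ n (i + t)
ϖ-∣ n zero    t = ∣-refl
ϖ-∣ n (suc i) t = ∣-trans (ϖ-∣ n i t) (m∣m*n (n ∸ (i + t)))

module MixedRadix (n : ℕ) (d : ℕ → ℕ) where

  value : ℕ → ℕ
  value t = Σ< t (λ i → d i * ϖ n i)

  value<ϖ : ∀ t → (∀ i → i < t → d i < n ∸ i) → value t < ϖ n t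
  value<ϖ zero    _  = z<s
  value<ϖ (suc t) d< = begin-strict
    value t + d t * ϖ n t <⟨ +-monoˡ-< (d t * ϖ n t) (value<ϖ t (λ i i<t → d< i (m<n⇒m<1+n i<t))) ⟩
    suc (d t) * ϖ n t     ≤⟨ *-monoˡ-≤ (ϖ n t) (d< t ≤-refl) ⟩
    (n ∸ t) * ϖ n t       ≡⟨ *-comm (n ∸ t) (ϖ n t) ⟩
    ϖ n t * (n ∸ t)       ∎
    where open ≤-Reasoning

  value-+ : ∀ i t → ∃[ A ] value (i + t) ≡ value t + A * ϖ n t
  value-+ zero    t = 0 , sym (+-identityʳ (value t))
  value-+ (suc i) t with value-+ i t | ϖ-∣ n i t
  ... | A , eq | divides c ϖ≡ = A + d (i + t) * c , (begin
    value (i + t) + d (i + t) * ϖ n (i + t)             ≡⟨ cong₂ (λ v w → v + d (i + t) * w) eq ϖ≡ ⟩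
    value t + A * ϖ n t + d (i + t) * (c * ϖ n t)        ≡⟨ solve 5 (λ v A W x c → v :+ A :* W :+ x :* (c :* W) := v :+ (A :+ x :* c) :* W)
                                                              refl (value t) A (ϖ n t) (d (i + t)) c ⟩
    value t + (A + d (i + t) * c) * ϖ n t               ∎)
    where open ≡-Reasoning

  value-split : ∀ {k l} → k < l → ∃[ A ] value l ≡ ((n ∸ k) * A + d k) * ϖ n k + value k
  value-split {k} {l} k<l with value-+ (l ∸ suc k) (suc k)
  ... | A , eq = A , (begin
    value l                                               ≡⟨ cong value (sym (m∸n+n≡m k<l)) ⟩
    value (l ∸ suc k + suc k)                             ≡⟨ eq ⟩
    value k + d k * ϖ n k + A * (ϖ n k * (n ∸ k))         ≡⟨ solve 5 (λ v x W A N → v :+ x :* W :+ A :* (W :* N) := (N :* A :+ x) :* W :+ v)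
                                                              refl (value k) (d k) (ϖ n k) A (n ∸ k) ⟩
    ((n ∸ k) * A + d k) * ϖ n k + value k                 ∎)
    where open ≡-Reasoning

proposition10 : (n k α : ℕ) → 2 ≤ n → k ≤ n ∸ 2 → α < n ! →
    (p : Perm) → at (𝒮 n) α ≡ just p →
    (d : ℕ → ℕ) → (∀ i → i ≤ n ∸ 2 → d i < n ∸ i) →
    α ≡ Σ< (n ∸ 1) (λ i → d i * ϖ n i) →
    (δ : ℕ) → δ < (n ∸ (k + 1)) ! → InOrbit n (k + 1) δ p →
    (∀ (r : Perm) → InOrbit n (k + 1) δ r ⇔ (∃[ j ] (j < n ∸ k × InOrbit n k ((n ∸ k) * δ + j) r)))
    × InOrbit n k ((n ∸ k) * δ + d k) p
    × (∀ j → j < n ∸ k → InOrbit n k ((n ∸ k) * δ + j) p → j ≡ d k)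
proposition10 n@(suc (suc m)) k α (s≤s (s≤s _)) k≤m _ p p≡pα d d< α≡ δ _ p∈δ =
  orbits , p∈d , only-d
  where
  open MixedRadix n d
  N : ℕ
  N = n ∸ k
  k+1≡suc-k : k + 1 ≡ suc k
  k+1≡suc-k = +-comm k 1
  orbits : ∀ r → InOrbit n (k + 1) δ r ⇔ (∃[ j ] (j < N × InOrbit n k (N * δ + j) r))
  orbits r = subst (λ t → InOrbit n t δ r ⇔ (∃[ j ] (j < N × InOrbit n k (N * δ + j) r)))
                   (sym k+1≡suc-k) (InOrbit-suc⇔ n k δ r)
  split : ∃[ A ] value (suc m) ≡ (N * A + d k) * ϖ n k + value k
  split = value-split (s≤s k≤m)
  A : ℕ
  A = Product.proj₁ split
  p∈dA : InOrbit n k (N * A + d k) p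
  p∈dA = value k , value<ϖ k (λ i i<k → d< i (≤-trans (<⇒≤ i<k) k≤m)) ,
         subst (λ i → at (𝒮 n) i ≡ just p) (trans α≡ (Product.proj₂ split)) p≡pα
  A≡δ : A ≡ δ
  A≡δ = InOrbit-unique n (suc k) (Equivalence.from (InOrbit-suc⇔ n k A p) (d k , d< k k≤m , p∈dA))
                                   (subst (λ t → InOrbit n t δ p) k+1≡suc-k p∈δ)
  p∈d : InOrbit n k (N * δ + d k) p
  p∈d = subst (λ a → InOrbit n k (N * a + d k) p) A≡δ p∈dA
  only-d : ∀ j → j < N → InOrbit n k (N * δ + j) p → j ≡ d k
  only-d j _ p∈j = +-cancelˡ-≡ (N * δ) j (d k) (InOrbit-unique n k p∈j p∈d)
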